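{- Let $X$ be a finite set, $n,s,k_1,\dots,k_s\in\mathbb{N}$ and $a\le\min X$. If $X$ is $\omega^{n+1}\cdot(a,ak_1,\dots,ak_s)$-large${}^*(\theta)$ and exp-sparse, and $f:X\to a$ is a coloring, then $X$ has an $f$-homogeneous (i.e. $f$-monochromatic) subset which is $\omega^n\cdot(k_1,\dots,k_s)$-large${}^*(\theta)$.
   Context: Fix a $\Delta^0_0$ formula $\theta(x,y,z)$. For finite sets, $A<B$ means every element of $A$ is below every element of $B$. Finite sets $E<F$ are $\theta$-apart if $\forall x<\max E\ \exists y<\min F\ \forall z<\max F\ \theta(x,y,z)$. For a family $\mathcal{L}$ of finite sets and $k$, $\mathcal{L}\cdot k$ is the family of finite sets containing $k$ pairwise $\theta$-apart sets $X_0<\dots<X_{k-1}$ each in $\mathcal{L}$; $\mathcal{L}\cdot()=\mathcal{L}$, $\mathcal{L}\cdot(k,k_2,\dots,k_s)=(\mathcal{L}\cdot k)\cdot(k_2,\dots,k_s)$. $L^\theta_0$ is the nonempty finite sets; $L^\theta_{n+1}$ is the nonempty finite $X$ with $X\setminus\{\min X\}\in L^\theta_n\cdot(\min X,\dots,\min X)$ ($n+1$ entries). $X$ is $\omega^n\cdot\sigma$-large${}^*(\theta)$ if $X\in L^\theta_n\cdot\sigma$ (for empty $\sigma$, $\omega^n$-large${}^*(\theta)$). A set $X$ is exp-sparse if $4^x<y$ for all $x<y$ in $X$. The integer $a$ is identified with $\{0,\dots,a-1\}$. -}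

module Defs where

open import Data.Nat using (ℕ; zero; suc; _<_; _≤_; _^_; _*_)
open import Data.Bool using (Bool; true)
open import Data.List using (List; []; _∷_; length; replicate; map)
open import Data.List.Membership.Propositional using (_∈_)
open import Data.List.Relation.Binary.Subset.Propositional using (_⊆_)
open import Data.List.Relation.Unary.All using (All)
open import Data.List.Relation.Unary.AllPairs using (AllPairs)
open import Data.List.Relation.Unary.Linked using (Linked)
open import Data.Product using (Σ; ∃; _×_)
open import Data.Empty using (⊥)
open import Relation.Binary.PropositionalEquality using (_≡_; _≢_)

-- Finite sets of naturals are represented by strictly increasing lists.
IsSet : List ℕ → Set
IsSet = Linked _<_

Fam : Set₁
Fam = List ℕ → Set

_<ˢ_ : List ℕ → List ℕ → Set
A <ˢ B = ∀ x y → x ∈ A → y ∈ B → x < y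

-- Apartness, for the fixed relation θ (given as a decidable, Bool-valued relation).
-- "x < max E" unfolds to "x < e for some e ∈ E";
-- "y < min F" unfolds to "y < f for all f ∈ F";
-- "z < max F" unfolds to "z < f for some f ∈ F".
Apart : (ℕ → ℕ → ℕ → Bool) → List ℕ → List ℕ → Set
Apart θ E F =
  E <ˢ F ×
  (∀ x → (∃ λ e → e ∈ E × x < e) →
     ∃ λ y → (∀ f → f ∈ F → y < f) ×
       (∀ z → (∃ λ f → f ∈ F × z < f) → θ x y z ≡ true))

_·[_]_ : Fam → (ℕ → ℕ → ℕ → Bool) → ℕ → Fam
(L ·[ θ ] k) X =
  Σ (List (List ℕ)) λ Bs →
    length Bs ≡ k ×
    All IsSet Bs ×
    All L Bs ×
    All (λ B → B ⊆ X) Bs ×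
    AllPairs (Apart θ) Bs

_·*[_]_ : Fam → (ℕ → ℕ → ℕ → Bool) → List ℕ → Fam
L ·*[ θ ] [] = L
L ·*[ θ ] (k ∷ ks) = (L ·[ θ ] k) ·*[ θ ] ks

Lθ : (ℕ → ℕ → ℕ → Bool) → ℕ → Fam
Lθ θ zero X = X ≢ []
Lθ θ (suc n) [] = ⊥
-- for a set (increasing list) m ∷ rest, min X = m and X \ {min X} = rest
Lθ θ (suc n) (m ∷ rest) = (Lθ θ n ·*[ θ ] replicate (suc n) m) rest

Large* : (ℕ → ℕ → ℕ → Bool) → ℕ → List ℕ → List ℕ → Set
Large* θ n σ X = (Lθ θ n ·*[ θ ] σ) X

ExpSparse : List ℕ → Set
ExpSparse X = ∀ x y → x ∈ X → y ∈ X → x < y → 4 ^ x < y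

Homogeneous : (ℕ → ℕ) → List ℕ → Set
Homogeneous f Y = ∃ λ c → ∀ y → y ∈ Y → f y ≡ c

-- The partition arrow "Lin ⟶ Lout" (every admissible set in Lin has an f-homogeneous
-- subset in Lout) survives the passage from Lin · (a k) to Lout · k: colour each of the
-- a k blocks homogeneously and keep k blocks of a common colour, which the pigeonhole
-- principle provides.  It therefore suffices to show L_{n+1} · a ⟶ L_n, by induction
-- on n.  Inside a set of L_{n+2} · a, walk through the a blocks collecting points of
-- pairwise distinct colours.  The first block m ∪ r yields a homogeneous L_{n+1}-set Z in r,
-- or a point of r whose colour differs from that of m.  Every later block
-- m' ∪ r' lies above the last collected point M, and exp-sparseness gives a M ≤ M² < m',
-- so r' is large enough for the induction hypothesis to produce a homogeneous set H in
-- L_n · (M, …, M) above M.  Either some collected point y has the colour of H, and then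
-- y ∪ H is a homogeneous L_{n+1}-set, or a point of H has a new colour.  As only a
-- colours exist, the a + 1 candidate points cannot all have distinct colours.
module Submission where

open import Defs
open import Data.Nat using (ℕ; zero; suc; _<_; _≤_; _*_; _+_; _^_; z≤n; s≤s; s≤s⁻¹; >-nonZero; _≟_; _<?_)
open import Data.Nat.Properties
open import Data.Bool using (Bool)
open import Data.List using (List; []; _∷_; map; length; replicate; take; concat; filter)
open import Data.List.Properties using (length-map; length-take; map-replicate)
open import Data.List.Membership.Propositional using (_∈_; find)
open import Data.List.Membership.Propositional.Properties using (∈-concat⁺′; ∈-concat⁻′)
open import Data.List.Relation.Unary.Any using (here; there; any?)
open import Data.List.Relation.Unary.All as All using (All; []; _∷_; all?)
import Data.List.Relation.Unary.All.Properties as AllP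
open import Data.List.Relation.Unary.AllPairs as AllPairs using (AllPairs; []; _∷_)
import Data.List.Relation.Unary.AllPairs.Properties as AllPairsP
open import Data.List.Relation.Unary.Linked using ([]; [-]; _∷_)
open import Data.List.Relation.Unary.Linked.Properties using (Linked⇒AllPairs; AllPairs⇒Linked)
open import Data.List.Relation.Binary.Pointwise as Pointwise using (Pointwise; []; _∷_; Pointwise-length)
open import Data.List.Relation.Binary.Subset.Propositional using (_⊆_)
open import Data.List.Relation.Binary.Sublist.Propositional using (⊆-refl)
open import Data.List.Relation.Binary.Sublist.Heterogeneous.Properties
  using (length-mono-≤; filter-Sublist; ⊆-filter-Sublist)
open import Data.Product using (Σ; ∃; _×_; _,_; proj₁; proj₂)
open import Data.Sum using (_⊎_; inj₁; inj₂)
open import Data.Empty using (⊥; ⊥-elim)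
open import Function using (_on_)
open import Relation.Nullary using (yes; no)
import Relation.Unary as U
open import Relation.Unary.Properties using (∁?)
open import Relation.Binary.PropositionalEquality using (_≡_; _≢_; refl; sym; trans; cong; subst)

n<2^n : ∀ n → n < 2 ^ n
n<2^n zero = s≤s z≤n
n<2^n (suc n) = +-mono-≤ (m^n>0 2 n) (subst (suc n ≤_) (sym (+-identityʳ (2 ^ n))) (n<2^n n))

n*n≤4^n : ∀ n → n * n ≤ 4 ^ n
n*n≤4^n n = begin
  n * n             ≤⟨ *-mono-≤ (<⇒≤ (n<2^n n)) (<⇒≤ (n<2^n n)) ⟩
  2 ^ n * 2 ^ n     ≡⟨ ^-distribˡ-+-* 2 n n ⟨
  2 ^ (n + n)       ≡⟨ cong (λ k → 2 ^ (n + k)) (+-identityʳ n) ⟨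
  2 ^ (2 * n)       ≡⟨ ^-*-assoc 2 2 n ⟨
  4 ^ n             ∎
  where open ≤-Reasoning

module _ {A : Set} {P : A → Set} (P? : U.Decidable P) where

  length-filter+filter-∁ : ∀ xs → length (filter P? xs) + length (filter (∁? P?) xs) ≡ length xs
  length-filter+filter-∁ [] = refl
  length-filter+filter-∁ (x ∷ xs) with P? x
  ... | yes _ = cong suc (length-filter+filter-∁ xs)
  ... | no _ = trans (+-suc _ _) (cong suc (length-filter+filter-∁ xs))

  length-filter-filter≤ : ∀ {Q : A → Set} (Q? : U.Decidable Q) xs →
    length (filter P? (filter Q? xs)) ≤ length (filter P? xs)
  length-filter-filter≤ Q? xs =
    length-mono-≤ (⊆-filter-Sublist P? P? (λ { refl p → p }) (filter-Sublist Q? (⊆-refl {x = xs})))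

module _ {A : Set} (colour : A → ℕ) where

  pigeonhole : ∀ b j xs → All (λ x → colour x < b) xs → b * j < length xs →
               ∃ λ c → c < b × j < length (filter (λ x → colour x ≟ c) xs)
  pigeonhole zero j [] [] ()
  pigeonhole zero j (x ∷ xs) (() ∷ _) _
  pigeonhole (suc b) j xs bounded long with j <? length (filter (λ x → colour x ≟ b) xs)
  ... | yes many = b , n<1+n b , many
  ... | no few with pigeonhole b j others others-bounded others-long
    where
    others : List A
    others = filter (∁? (λ x → colour x ≟ b)) xs
    others-bounded : All (λ x → colour x < b) others
    others-bounded = All.zipWith (λ (<1+b , ≢b) → ≤∧≢⇒< (s≤s⁻¹ <1+b) ≢b)
      (AllP.filter⁺ (∁? (λ x → colour x ≟ b)) bounded , AllP.all-filter (∁? (λ x → colour x ≟ b)) xs)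
    others-long : b * j < length others
    others-long = +-cancelˡ-< j _ _ (begin-strict
      j + b * j                                               <⟨ long ⟩
      length xs                                               ≡⟨ length-filter+filter-∁ (λ x → colour x ≟ b) xs ⟨
      length (filter (λ x → colour x ≟ b) xs) + length others ≤⟨ +-monoˡ-≤ _ (≮⇒≥ few) ⟩
      j + length others                                       ∎)
      where open ≤-Reasoning
  ... | c , c<b , many = c , m<n⇒m<1+n c<b ,
    <-≤-trans many (length-filter-filter≤ (λ x → colour x ≟ c) (∁? (λ x → colour x ≟ b)) xs)

  rainbow-length≤ : ∀ b xs → All (λ x → colour x < b) xs →
                    AllPairs (λ x y → colour x ≢ colour y) xs → length xs ≤ b
  rainbow-length≤ b xs bounded distinct = ≮⇒≥ λ b<length →
    let c , _ , two = pigeonhole b 1 xs bounded (subst (_< length xs) (sym (*-identityʳ b)) b<length)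
    in monochromatic-pair two (AllP.all-filter (λ x → colour x ≟ c) xs)
                             (AllPairsP.filter⁺ (λ x → colour x ≟ c) distinct)
    where
    monochromatic-pair : ∀ {c ys} → 1 < length ys → All (λ y → colour y ≡ c) ys →
                         AllPairs (λ x y → colour x ≢ colour y) ys → ⊥
    monochromatic-pair {ys = _ ∷ _ ∷ _} _ (x≡c ∷ y≡c ∷ _) ((x≢y ∷ _) ∷ _) = x≢y (trans x≡c (sym y≡c))
    monochromatic-pair {ys = _ ∷ []} (s≤s ()) _ _

AllPairs-pointwise : ∀ {A B : Set} {R : A → A → Set} {S : B → B → Set} {T : A → B → Set} →
  (∀ {x x' y y'} → T x y → T x' y' → S y y' → R x x') →
  ∀ {xs ys} → Pointwise T xs ys → AllPairs S ys → AllPairs R xs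
AllPairs-pointwise shrink [] [] = []
AllPairs-pointwise {R = R} {S} {T} shrink (t ∷ ts) (Sy ∷ Sys) = heads t ts Sy ∷ AllPairs-pointwise shrink ts Sys
  where
  heads : ∀ {x y xs ys} → T x y → Pointwise T xs ys → All (S y) ys → All (R x) xs
  heads t [] [] = []
  heads t (t' ∷ ts) (s ∷ ss) = shrink t t' s ∷ heads t ts ss

cons-IsSet : ∀ {y xs} → (∀ x → x ∈ xs → y < x) → IsSet xs → IsSet (y ∷ xs)
cons-IsSet {xs = []} _ _ = [-]
cons-IsSet {xs = x ∷ _} y<xs s = y<xs x (here refl) ∷ s

IsSet-tail : ∀ {x xs} → IsSet (x ∷ xs) → IsSet xs
IsSet-tail [-] = []
IsSet-tail (_ ∷ s) = s

IsSet-head< : ∀ {x xs} → IsSet (x ∷ xs) → ∀ y → y ∈ xs → x < y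
IsSet-head< s y y∈xs = All.lookup (AllPairs.head (Linked⇒AllPairs <-trans s)) y∈xs

concat-IsSet : ∀ {Ys} → All IsSet Ys → AllPairs _<ˢ_ Ys → IsSet (concat Ys)
concat-IsSet sets ordered = AllPairs⇒Linked (AllPairsP.concat⁺
  (All.map (Linked⇒AllPairs <-trans) sets)
  (AllPairs.map (λ A<B → All.tabulate λ x∈A → All.tabulate λ y∈B → A<B _ _ x∈A y∈B) ordered))

concat-⊆ : ∀ {Ys : List (List ℕ)} {X} → All (_⊆ X) Ys → concat Ys ⊆ X
concat-⊆ {Ys} subs y∈ = let _ , y∈Y , Y∈Ys = ∈-concat⁻′ Ys y∈ in All.lookup subs Y∈Ys y∈Y

⊆-concat : ∀ (Ys : List (List ℕ)) → All (_⊆ concat Ys) Ys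
⊆-concat Ys = All.tabulate λ Y∈Ys y∈Y → ∈-concat⁺′ y∈Y Y∈Ys

Apart-anti : ∀ {θ E F E' F'} → E' ⊆ E → F' ⊆ F → Apart θ E F → Apart θ E' F'
Apart-anti E'⊆E F'⊆F (E<F , apart) =
  (λ x y x∈ y∈ → E<F x y (E'⊆E x∈) (F'⊆F y∈)) ,
  λ x (e , e∈ , x<e) →
    let y , y<F , θ-holds = apart x (e , E'⊆E e∈ , x<e)
    in y , (λ f f∈ → y<F f (F'⊆F f∈)) , λ z (f , f∈ , z<f) → θ-holds z (f , F'⊆F f∈ , z<f)

module _ {θ : ℕ → ℕ → ℕ → Bool} where

  ·-mono : ∀ {L L' k k'} → L U.⊆ L' → k' ≤ k → (L ·[ θ ] k) U.⊆ (L' ·[ θ ] k')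
  ·-mono {k' = k'} L⊆L' k'≤k (Bs , refl , sets , Ls , subs , apart) =
    take k' Bs , trans (length-take k' Bs) (m≤n⇒m⊓n≡m k'≤k) ,
    AllP.take⁺ k' sets , AllP.take⁺ k' (All.map L⊆L' Ls) , AllP.take⁺ k' subs ,
    AllPairsP.take⁺ k' apart

  ·*-mono : ∀ {L L' ks ks'} → L U.⊆ L' → Pointwise _≤_ ks' ks → (L ·*[ θ ] ks) U.⊆ (L' ·*[ θ ] ks')
  ·*-mono L⊆L' [] = L⊆L'
  ·*-mono L⊆L' (k'≤k ∷ ks'≤ks) = ·*-mono (·-mono L⊆L' k'≤k) ks'≤ks

  ·*-component : ∀ {L X} ks → All (1 ≤_) ks → IsSet X → (L ·*[ θ ] ks) X →
                 ∃ λ Z → IsSet Z × Z ⊆ X × L Z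
  ·*-component [] [] sX LX = _ , sX , (λ z∈ → z∈) , LX
  ·*-component (k ∷ ks) (s≤s z≤n ∷ 1≤ks) sX LX with ·*-component ks 1≤ks sX LX
  ... | Z , _ , Z⊆X , (B ∷ _ , _ , sB ∷ _ , LB ∷ _ , B⊆Z ∷ _ , _) = B , sB , (λ b∈ → Z⊆X (B⊆Z b∈)) , LB
  ... | _ , _ , _ , ([] , () , _)

  Lθ-nonempty : ∀ n {Z} → Lθ θ n Z → ∃ λ z → z ∈ Z
  Lθ-nonempty zero {[]} nonempty = ⊥-elim (nonempty refl)
  Lθ-nonempty zero {z ∷ _} _ = z , here refl
  Lθ-nonempty (suc n) {z ∷ _} _ = z , here refl

module Arrow (θ : ℕ → ℕ → ℕ → Bool) (a : ℕ) (f : ℕ → ℕ) (1≤a : 1 ≤ a) where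

  Admissible : List ℕ → Set
  Admissible X = (∀ x → x ∈ X → a ≤ x) × (∀ x → x ∈ X → f x < a) × ExpSparse X

  Admissible-⊆ : ∀ {X Y} → Y ⊆ X → Admissible X → Admissible Y
  Admissible-⊆ Y⊆X (a≤X , f<a , sparse) =
    (λ x x∈ → a≤X x (Y⊆X x∈)) , (λ x x∈ → f<a x (Y⊆X x∈)) ,
    λ x y x∈ y∈ → sparse x y (Y⊆X x∈) (Y⊆X y∈)

  record HomogeneousSubset (L : Fam) (X : List ℕ) : Set where
    field
      elements : List ℕ
      colour : ℕ
      colour<a : colour < a
      isSet : IsSet elements
      ⊆X : elements ⊆ X
      homogeneous : ∀ y → y ∈ elements → f y ≡ colour
      large : L elements

  open HomogeneousSubset

  weaken : ∀ {L X Y} → Y ⊆ X → HomogeneousSubset L Y → HomogeneousSubset L X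
  weaken Y⊆X H = record
    { elements = elements H ; colour = colour H ; colour<a = colour<a H ; isSet = isSet H
    ; ⊆X = λ y∈ → Y⊆X (⊆X H y∈) ; homogeneous = homogeneous H ; large = large H }

  _⟶_ : Fam → Fam → Set
  Lin ⟶ Lout = ∀ {X} → IsSet X → Admissible X → Lin X → HomogeneousSubset Lout X

  homogeneous-blocks : ∀ {Lin Lout X} → Lin ⟶ Lout → Admissible X → ∀ {Bs} →
    All IsSet Bs → All Lin Bs → All (_⊆ X) Bs → AllPairs (Apart θ) Bs →
    ∃ λ (Hs : List (HomogeneousSubset Lout X)) → length Hs ≡ length Bs × AllPairs (Apart θ on elements) Hs
  homogeneous-blocks {Lin} {Lout} {X} arrow adm sets Ls subs apart =
    let Hs , Hs⊆Bs = blockwise sets Ls subs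
    in Hs , Pointwise-length Hs⊆Bs , AllPairs-pointwise (Apart-anti {θ}) Hs⊆Bs apart
    where
    blockwise : ∀ {Bs} → All IsSet Bs → All Lin Bs → All (_⊆ X) Bs →
      Σ (List (HomogeneousSubset Lout X)) λ Hs → Pointwise (λ H B → elements H ⊆ B) Hs Bs
    blockwise [] [] [] = [] , []
    blockwise (sB ∷ sets) (LB ∷ Ls) (B⊆X ∷ subs) =
      let H = arrow sB (Admissible-⊆ B⊆X adm) LB
          Hs , Hs⊆Bs = blockwise sets Ls subs
      in weaken B⊆X H ∷ Hs , ⊆X H ∷ Hs⊆Bs

  ⋃-homogeneous : ∀ {L X c k} (Hs : List (HomogeneousSubset L X)) → length Hs ≡ k → c < a →
    All (λ H → colour H ≡ c) Hs → AllPairs (Apart θ on elements) Hs →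
    HomogeneousSubset (L ·[ θ ] k) X
  ⋃-homogeneous {L} {X} {c} Hs refl c<a monochromatic apart = record
    { elements = concat Ys
    ; colour = c
    ; colour<a = c<a
    ; isSet = concat-IsSet (AllP.map⁺ (All.universal isSet Hs)) (AllPairs.map proj₁ apart')
    ; ⊆X = concat-⊆ (AllP.map⁺ (All.universal ⊆X Hs))
    ; homogeneous = λ y y∈ →
        let _ , y∈Y , Y∈Ys = ∈-concat⁻′ Ys y∈ in All.lookup homogeneous-Ys Y∈Ys y y∈Y
    ; large = Ys , length-map elements Hs , AllP.map⁺ (All.universal isSet Hs) ,
              AllP.map⁺ (All.universal large Hs) , ⊆-concat Ys , apart'
    }
    where
    Ys : List (List ℕ)
    Ys = map elements Hs
    apart' : AllPairs (Apart θ) Ys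
    apart' = AllPairsP.map⁺ apart
    homogeneous-Ys : All (λ Y → ∀ y → y ∈ Y → f y ≡ c) Ys
    homogeneous-Ys = AllP.map⁺ (All.map (λ {H} H≡c y y∈ → trans (homogeneous H y y∈) H≡c) monochromatic)

  ·-arrow : ∀ {Lin Lout} k → Lin ⟶ Lout → (Lin ·[ θ ] (a * k)) ⟶ (Lout ·[ θ ] k)
  ·-arrow zero _ _ _ _ = ⋃-homogeneous [] refl 1≤a [] []
  ·-arrow (suc j) arrow _ adm (_ , length≡ , sets , Ls , subs , apart)
    with Hs , length-Hs , apart-Hs ← homogeneous-blocks arrow adm sets Ls subs apart
    with c , c<a , many ← pigeonhole colour a j Hs (All.universal colour<a Hs)
           (subst (a * j <_) (sym (trans length-Hs length≡)) (*-monoʳ-< a {{>-nonZero 1≤a}} (n<1+n j)))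
    = let same = filter (λ H → colour H ≟ c) Hs
      in ⋃-homogeneous (take (suc j) same) (trans (length-take (suc j) same) (m≤n⇒m⊓n≡m many)) c<a
           (AllP.take⁺ (suc j) (AllP.all-filter (λ H → colour H ≟ c) Hs))
           (AllPairsP.take⁺ (suc j) (AllPairsP.filter⁺ (λ H → colour H ≟ c) apart-Hs))

  ·*-arrow : ∀ {Lin Lout} ks → Lin ⟶ Lout → (Lin ·*[ θ ] map (a *_) ks) ⟶ (Lout ·*[ θ ] ks)
  ·*-arrow [] arrow = arrow
  ·*-arrow (k ∷ ks) arrow = ·*-arrow ks (·-arrow k arrow)

  cons-homogeneous : ∀ {n X y M} → y ∈ X → y ≤ M →
    (H : HomogeneousSubset (Lθ θ n ·*[ θ ] replicate (suc n) M) X) → (∀ h → h ∈ elements H → M < h) →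
    f y ≡ colour H → HomogeneousSubset (Lθ θ (suc n)) X
  cons-homogeneous {n} y∈X y≤M H M<H fy≡c = record
    { elements = _ ∷ elements H
    ; colour = colour H
    ; colour<a = colour<a H
    ; isSet = cons-IsSet (λ h h∈ → ≤-<-trans y≤M (M<H h h∈)) (isSet H)
    ; ⊆X = λ { (here refl) → y∈X ; (there h∈) → ⊆X H h∈ }
    ; homogeneous = λ { _ (here refl) → fy≡c ; h (there h∈) → homogeneous H h h∈ }
    ; large = ·*-mono (λ LZ → LZ) (Pointwise.replicate⁺ y≤M (suc n)) (large H)
    }

  module Step (n : ℕ) (arrow : (Lθ θ (suc n) ·[ θ ] a) ⟶ Lθ θ n) {X : List ℕ} (adm : Admissible X) where

    a≤X : ∀ x → x ∈ X → a ≤ x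
    a≤X = proj₁ adm

    f<a : ∀ x → x ∈ X → f x < a
    f<a = proj₁ (proj₂ adm)

    sparse : ExpSparse X
    sparse = proj₂ (proj₂ adm)

    Block : List ℕ → Set
    Block C = IsSet C × Lθ θ (suc (suc n)) C × C ⊆ X

    Above : ℕ → List ℕ → Set
    Above M C = ∀ x → x ∈ C → M < x

    homogeneous-tail : ∀ {M m r} → M ∈ X → Block (m ∷ r) → M < m →
                       HomogeneousSubset (Lθ θ n ·*[ θ ] replicate (suc n) M) r
    homogeneous-tail {M} {m} M∈X (sC , LC , C⊆X) M<m =
      ·*-arrow (replicate (suc n) M) arrow (IsSet-tail sC) (Admissible-⊆ (λ x∈ → C⊆X (there x∈)) adm)
        (·*-mono (λ LZ → LZ) bounds LC)
      where
      a*M≤m : a * M ≤ m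
      a*M≤m = begin
        a * M  ≤⟨ *-monoˡ-≤ M (a≤X M M∈X) ⟩
        M * M  ≤⟨ n*n≤4^n M ⟩
        4 ^ M  <⟨ sparse M m M∈X (C⊆X (here refl)) M<m ⟩
        m      ∎
        where open ≤-Reasoning
      bounds : Pointwise _≤_ (a ∷ map (a *_) (replicate (suc n) M)) (replicate (suc (suc n)) m)
      bounds = a≤X m (C⊆X (here refl)) ∷
        subst (λ ks → Pointwise _≤_ ks (replicate (suc n) m)) (sym (map-replicate (a *_) (suc n) M))
          (Pointwise.replicate⁺ a*M≤m (suc n))

    record Rainbow : Set where
      field
        top : ℕ
        below : List ℕ
        points⊆X : top ∷ below ⊆ X
        ≤top : ∀ y → y ∈ top ∷ below → y ≤ top
        distinct : AllPairs (λ y z → f y ≢ f z) (top ∷ below)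

      points : List ℕ
      points = top ∷ below

    open Rainbow

    singleton : ∀ {m} → m ∈ X → Rainbow
    singleton m∈X = record
      { top = _ ; below = []
      ; points⊆X = λ { (here refl) → m∈X }
      ; ≤top = λ { _ (here refl) → ≤-refl }
      ; distinct = [] ∷ []
      }

    extend : (R : Rainbow) → ∀ {h} → h ∈ X → top R < h → All (λ y → f h ≢ f y) (points R) → Rainbow
    extend R h∈X top<h new = record
      { top = _ ; below = points R
      ; points⊆X = λ { (here refl) → h∈X ; (there y∈) → points⊆X R y∈ }
      ; ≤top = λ { _ (here refl) → ≤-refl ; y (there y∈) → <⇒≤ (≤-<-trans (≤top R y y∈) top<h) }
      ; distinct = new ∷ distinct R
      }

    first-block : ∀ {m r} → Block (m ∷ r) → HomogeneousSubset (Lθ θ (suc n)) X ⊎ ∃ λ z → z ∈ r × f z ≢ f m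
    first-block {m} {r} (sC , LC , C⊆X)
      with Z , sZ , Z⊆r , LZ ← ·*-component (replicate (suc (suc n)) m)
             (AllP.replicate⁺ (suc (suc n)) (≤-trans 1≤a (a≤X m (C⊆X (here refl))))) (IsSet-tail sC) LC
      with all? (λ z → f z ≟ f m) Z
    ... | yes monochromatic = inj₁ (record
      { elements = Z ; colour = f m ; colour<a = f<a m (C⊆X (here refl)) ; isSet = sZ
      ; ⊆X = λ z∈ → C⊆X (there (Z⊆r z∈)) ; homogeneous = λ _ z∈ → All.lookup monochromatic z∈
      ; large = LZ })
    ... | no mixed =
      let z , z∈Z , fz≢fm = find (AllP.¬All⇒Any¬ (λ z → f z ≟ f m) Z mixed) in inj₂ (z , Z⊆r z∈Z , fz≢fm)

    next-block : (R : Rainbow) → ∀ {C} → Block C → Above (top R) C →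
           HomogeneousSubset (Lθ θ (suc n)) X ⊎ ∃ λ h → h ∈ C × All (λ y → f h ≢ f y) (points R)
    next-block R {[]} (_ , () , _) _
    next-block R {m ∷ r} block@(_ , _ , C⊆X) above
      with H ← homogeneous-tail (points⊆X R (here refl)) block (above m (here refl))
      with any? (λ y → f y ≟ colour H) (points R)
    ... | yes match =
      let y , y∈ , fy≡c = find match
      in inj₁ (cons-homogeneous (points⊆X R y∈) (≤top R y y∈) (weaken (λ x∈ → C⊆X (there x∈)) H)
                 (λ h h∈ → above h (there (⊆X H h∈))) fy≡c)
    ... | no none =
      let Z , _ , Z⊆H , LZ = ·*-component (replicate (suc n) (top R))
                               (AllP.replicate⁺ (suc n) (≤-trans 1≤a (a≤X _ (points⊆X R (here refl)))))
                               (isSet H) (large H)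
          h , h∈Z = Lθ-nonempty n LZ
          fh≡c = homogeneous H h (Z⊆H h∈Z)
      in inj₂ (h , there (⊆X H (Z⊆H h∈Z)) ,
               All.map (λ fy≢c fh≡fy → fy≢c (trans (sym fh≡fy) fh≡c)) (AllP.¬Any⇒All¬ (points R) none))

    collect : (R : Rainbow) → ∀ {Cs} → All Block Cs → AllPairs _<ˢ_ Cs → All (Above (top R)) Cs →
           a < length (points R) + length Cs → HomogeneousSubset (Lθ θ (suc n)) X
    collect R [] [] [] too-many = ⊥-elim (<⇒≱ (subst (a <_) (+-identityʳ _) too-many)
      (rainbow-length≤ f a (points R) (All.tabulate λ y∈ → f<a _ (points⊆X R y∈)) (distinct R)))
    collect R (block ∷ blocks) (C<Cs ∷ ordered) (above ∷ aboves) too-many with next-block R block above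
    ... | inj₁ H = H
    ... | inj₂ (h , h∈C , new) =
      collect (extend R (proj₂ (proj₂ block) h∈C) (above h h∈C) new) blocks ordered
        (All.map (λ C<C' x x∈ → C<C' h x h∈C x∈) C<Cs) (subst (a <_) (+-suc (length (points R)) _) too-many)

    Lθ·a-arrow : (Lθ θ (suc (suc n)) ·[ θ ] a) X → HomogeneousSubset (Lθ θ (suc n)) X
    Lθ·a-arrow ([] , length≡ , _) = ⊥-elim (<⇒≢ 1≤a length≡)
    Lθ·a-arrow ([] ∷ _ , _ , _ , () ∷ _ , _)
    Lθ·a-arrow ((m ∷ r) ∷ Cs , length≡ , sC ∷ sets , LC ∷ Ls , C⊆X ∷ subs , C-apart ∷ apart)
      with first-block (sC , LC , C⊆X)
    ... | inj₁ H = H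
    ... | inj₂ (z , z∈r , fz≢fm) =
      collect (extend (singleton (C⊆X (here refl))) (C⊆X (there z∈r)) (IsSet-head< sC z z∈r) (fz≢fm ∷ []))
        (All.zip (sets , All.zip (Ls , subs))) (AllPairs.map proj₁ apart)
        (All.map (λ C<C' x x∈ → C<C' z x (there z∈r) x∈) (All.map proj₁ C-apart))
        (s≤s (≤-reflexive (sym length≡)))

  Lθ-arrow : ∀ n → (Lθ θ (suc n) ·[ θ ] a) ⟶ Lθ θ n
  Lθ-arrow zero sX adm X-large
    with B , _ , B⊆X , LB ← ·*-component (a ∷ []) (1≤a ∷ []) sX X-large
    with y , y∈B ← Lθ-nonempty 1 LB = record
      { elements = y ∷ [] ; colour = f y ; colour<a = proj₁ (proj₂ adm) y (B⊆X y∈B) ; isSet = [-]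
      ; ⊆X = λ { (here refl) → B⊆X y∈B ; (there ()) }
      ; homogeneous = λ { _ (here refl) → refl ; _ (there ()) }
      ; large = λ () }
  Lθ-arrow (suc n) _ adm = Step.Lθ·a-arrow n (Lθ-arrow n) adm

proposition3p17 : (θ : ℕ → ℕ → ℕ → Bool) (X : List ℕ) (n : ℕ) (ks : List ℕ) (a : ℕ) →
    IsSet X → X ≢ [] → (∀ x → x ∈ X → a ≤ x) →
    Large* θ (suc n) (a ∷ map (a *_) ks) X →
    ExpSparse X →
    (f : ℕ → ℕ) → (∀ x → x ∈ X → f x < a) →
    Σ (List ℕ) λ Y → IsSet Y × Y ⊆ X × Homogeneous f Y × Large* θ n ks Y
proposition3p17 θ [] n ks a _ nonempty _ _ _ _ _ = ⊥-elim (nonempty refl)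
proposition3p17 θ (x ∷ xs) n ks a sX _ a≤X X-large sparse f f<a =
  elements H , isSet H , ⊆X H , (colour H , homogeneous H) , large H
  where
  open Arrow θ a f (≤-<-trans z≤n (f<a x (here refl)))
  open HomogeneousSubset
  H : HomogeneousSubset (Lθ θ n ·*[ θ ] ks) (x ∷ xs)
  H = ·*-arrow ks (Lθ-arrow n) sX (a≤X , f<a , sparse) X-large
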